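{- Let $p>2$ be a prime such that $\mathrm{Cl}(p^2+4)$ is trivial, and let $\omega_1,\omega_2,\omega_3\in\mathbb{Z}_{\ge2}\cup\{\infty\}$ with (at least) one $\omega_i$ finite. If $m=(2+p^2)^2\pm p^{\alpha}k^2$ for some integers $\alpha\ge0$, $k>0$ with $p\nmid k$ (and $m\notin\{0,4\}$), then $(\mathcal{X}_m,\mathcal{D}_{\underline\omega})^*_{\mathrm{str}}(\mathbb{Z})\ne\emptyset$ (for both Campana and Darmon points).
   Context: For $D\in\mathbb{Z}$, $D\equiv0,1\bmod4$, $\mathrm{Cl}(D)$ denotes the class group of (primitive) integral binary quadratic forms of discriminant $D$ up to $\mathrm{GL}_2(\mathbb{Z})$-equivalence; "trivial" means it has one element. For $m\in\mathbb{Z}\setminus\{0,4\}$: $U_m\subset\mathbb{A}^3_{\mathbb{Q}}$ is $u_1^2+u_2^2+u_3^2-u_1u_2u_3=m$; $\mathcal{X}_m\subset\mathbb{P}^3_{\mathbb{Z}}$ is $x_0(x_1^2+x_2^2+x_3^2)-x_1x_2x_3=mx_0^3$ with generic fibre $X_m$, $U_m=X_m\cap\{x_0\ne0\}$ via $u_l=x_l/x_0$. $D_l=\{x_0=x_l=0\}$, $\mathcal{D}_l$ its closure in $\mathcal{X}_m$, $\mathcal{D}_{\underline\omega}=\sum(1-1/\omega_l)\mathcal{D}_l$, $\mathcal{D}_{\inf}=\bigcup_{\omega_l=\infty}\mathcal{D}_l$. For a prime $q$ and $M_q\in\mathcal{X}_m(\mathbb{Z}_q)$, write $\mathrm{Spec}\,\mathbb{Z}_q\times_{\mathcal{X}_m}\mathcal{D}_l=\mathrm{Spec}(\mathbb{Z}_q/I)$,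 $n_q(\mathcal{D}_l,M_q)=\infty$ if $I=0$, $=n$ if $I=(q^n)$. $(\mathcal{X}_m,\mathcal{D}_{\underline\omega})^*_{\mathrm{str}}(\mathbb{Z})$ is the set of $M\in U_m(\mathbb{Q})$ such that for every prime $q$, $M\in(\mathcal{X}_m\setminus\mathcal{D}_{\inf})(\mathbb{Z}_q)$ and for every $l$ with $\omega_l<\infty$, $n_q(\mathcal{D}_l,M)\in\mathbb{Z}_{\ge\omega_l}\cup\{0,\infty\}$ (Campana) resp. $\in\omega_l\mathbb{Z}_{\ge0}\cup\{\infty\}$ (Darmon). -}

module Defs where

open import Data.Nat as ℕ using (ℕ; _≤_)
open import Data.Nat.Primality using (Prime)
open import Data.Nat.Divisibility as ℕd using ()
open import Data.Integer as ℤ using (ℤ; +_; _+_; _-_; _*_; _^_; ∣_∣; -_)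
open import Data.Integer.Divisibility as ℤd using ()
open import Data.Fin using (Fin; zero; suc)
open import Data.Product using (Σ; _×_; ∃)
open import Data.Sum using (_⊎_)
open import Relation.Binary.PropositionalEquality using (_≡_; _≢_)
open import Relation.Nullary using (¬_)

record BQF : Set where
  constructor form
  field
    a b c : ℤ

open BQF public

disc : BQF → ℤ
disc f = b f * b f - + 4 * a f * c f

PrimitiveForm : BQF → Set
PrimitiveForm f = ∀ (d : ℤ) → d ℤd.∣ a f → d ℤd.∣ b f → d ℤd.∣ c f → ∣ d ∣ ≡ 1

evalF : BQF → ℤ → ℤ → ℤ
evalF f x y = a f * x * x + b f * x * y + c f * y * y

-- g(x,y) = f(αx+βy, γx+δy) for some (α β; γ δ) ∈ GL₂(ℤ)
GL2Equiv : BQF → BQF → Set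
GL2Equiv f g = Σ ℤ λ α → Σ ℤ λ β → Σ ℤ λ γ → Σ ℤ λ δ →
  ((α * δ - β * γ ≡ + 1) ⊎ (α * δ - β * γ ≡ - + 1)) ×
  (a g ≡ evalF f α γ) ×
  (b g ≡ + 2 * a f * α * β + b f * (α * δ + β * γ) + + 2 * c f * γ * δ) ×
  (c g ≡ evalF f β δ)

-- Cl(D) has exactly one element (primitive forms of disc. D modulo GL₂(ℤ))
ClTrivial : ℤ → Set
ClTrivial D =
  (Σ BQF λ f → PrimitiveForm f × disc f ≡ D) ×
  (∀ f g → PrimitiveForm f → disc f ≡ D → PrimitiveForm g → disc g ≡ D → GL2Equiv f g)

data Weight : Set where
  fin : (w : ℕ) → 2 ≤ w → Weight
  ∞   : Weight

IsFinite : Weight → Set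
IsFinite (fin _ _) = Data.Unit.⊤ where import Data.Unit
IsFinite ∞ = Data.Empty.⊥ where import Data.Empty

data Kind : Set where
  campana darmon : Kind

-- A point of U_m(ℚ) is represented by its primitive integral
-- homogeneous coordinates (x₀ : x₁ : x₂ : x₃) with x₀ ≠ 0 (u_l = x_l/x₀);
-- these coordinates also give the ℤ_q-point of 𝒳_m for every prime q.

OnX : ℤ → ℤ → (Fin 3 → ℤ) → Set
OnX m x0 x =
  x0 * (x zero * x zero + x (suc zero) * x (suc zero) + x (suc (suc zero)) * x (suc (suc zero)))
    - x zero * x (suc zero) * x (suc (suc zero))
  ≡ m * x0 ^ 3

PrimitiveCoords : ℤ → (Fin 3 → ℤ) → Set
PrimitiveCoords x0 x = ∀ (q : ℕ) → Prime q →
  ¬ ((+ q ℤd.∣ x0) × (+ q ℤd.∣ x zero) × (+ q ℤd.∣ x (suc zero)) × (+ q ℤd.∣ x (suc (suc zero))))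

-- n_q(𝒟_l, M) = n : the ideal (x₀, x_l) ⊆ ℤ_q equals (q^n)
-- (no n exists iff the ideal is 0, i.e. n_q = ∞)
IdealVal : ℕ → ℤ → ℤ → ℕ → Set
IdealVal q s t n =
  (+ (q ℕ.^ n) ℤd.∣ s) × (+ (q ℕ.^ n) ℤd.∣ t) ×
  ¬ ((+ (q ℕ.^ ℕ.suc n) ℤd.∣ s) × (+ (q ℕ.^ ℕ.suc n) ℤd.∣ t))

Allowed : Kind → Weight → ℕ → Set
Allowed _       ∞         n = n ≡ 0        -- point avoids 𝒟_l (l ∈ 𝒟_inf)
Allowed campana (fin w _) n = n ≡ 0 ⊎ w ≤ n
Allowed darmon  (fin w _) n = w ℕd.∣ n

LocalCond : Kind → Weight → ℕ → ℤ → ℤ → Set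
LocalCond κ ω q x0 xl = ∀ n → IdealVal q x0 xl n → Allowed κ ω n

StrPoint : Kind → ℤ → (Fin 3 → Weight) → ℤ → (Fin 3 → ℤ) → Set
StrPoint κ m ω x0 x =
  x0 ≢ + 0 × PrimitiveCoords x0 x × OnX m x0 x ×
  (∀ (l : Fin 3) (q : ℕ) → Prime q → LocalCond κ (ω l) q x0 (x l))

{-# OPTIONS --safe #-}
module Submission where

-- The point is explicit.  Let w ≥ 2 be a finite weight, x₀ = pʷ and r = p² + 2.  On
-- x₁ = r x₀ the surface equation reads X² + Y² − r X Y = (m − r²) x₀² in the two remaining
-- coordinates, and for X = k(B − pA), Y = kB its left side is p²k²(A² + pAB − B²), p²k² times
-- the norm form of ℤ[θ], θ² = pθ + 1.  The elements (1 + θ)ⁿ and θ(1 + θ)ⁿ have norm ±pⁿ and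
-- θ-coordinate ≡ 2ⁿ⁻¹ (mod p), so n = α + 2w − 2 gives m = r² ± p^α k² with p ∤ kB.  Placing
-- r x₀ in a coordinate l of weight ω_l = w, the ideal (x₀, x_l) is (pʷ) while x₀ is coprime to
-- X and Y, which is what both the Campana and the Darmon conditions ask for.

open import Defs
open import Data.Nat as ℕ using (ℕ; zero; suc; _<_; _≤_; _∸_; NonZero)
import Data.Nat.Properties as ℕ
open import Data.Nat.Divisibility using (_∣_; ∣-trans; ∣-refl; _∣0; m∣m*n; n∣m*n; ∣1⇒≡1; ∣⇒≤)
open import Data.Nat.Primality using (Prime; euclidsLemma; prime⇒irreducible; prime⇒nonTrivial; prime⇒nonZero)
open import Data.Integer as ℤ using (ℤ; +_; _+_; _-_; _*_; _^_; -_; ∣_∣)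
import Data.Integer.Properties as ℤ
import Data.Integer.Divisibility.Signed as Signed
open import Data.Integer.Tactic.RingSolver using (solve-∀)
open import Data.Fin using (Fin; zero; suc; punchIn; punchOut; _≟_)
open import Data.Fin.Properties using (punchIn-punchOut)
open import Data.Vec using (Vec; []; _∷_; lookup; insertAt)
open import Data.Vec.Properties using (insertAt-lookup; insertAt-punchIn)
open import Data.Product using (Σ; ∃; ∃₂; _×_; _,_; proj₁; proj₂; uncurry)
open import Data.Sum using (_⊎_; inj₁; inj₂; [_,_]′)
open import Function using (id; _∘_)
open import Relation.Binary.PropositionalEquality
open import Relation.Nullary using (¬_; yes; no; contradiction)

prime∣^⇒∣ : ∀ {q} m n → Prime q → q ∣ m ℕ.^ n → q ∣ m
prime∣^⇒∣ m zero    q-prime q∣1 = contradiction (∣1⇒≡1 q∣1) (ℕ.nonTrivial⇒≢1 {{prime⇒nonTrivial q-prime}})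
prime∣^⇒∣ m (suc n) q-prime q∣mⁿ⁺¹ =
  [ id , prime∣^⇒∣ m n q-prime ]′ (euclidsLemma m (m ℕ.^ n) q-prime q∣mⁿ⁺¹)

prime∣prime^⇒≡ : ∀ {q p w} → Prime q → Prime p → q ∣ p ℕ.^ w → q ≡ p
prime∣prime^⇒≡ {w = w} q-prime p-prime q∣pʷ =
  [ (λ q≡1 → contradiction q≡1 (ℕ.nonTrivial⇒≢1 {{prime⇒nonTrivial q-prime}})) , id ]′
    (prime⇒irreducible p-prime (prime∣^⇒∣ _ w q-prime q∣pʷ))

^-monoʳ-∣ : ∀ p {m n} → m ≤ n → p ℕ.^ m ∣ p ℕ.^ n
^-monoʳ-∣ p {m} {n} m≤n = subst (p ℕ.^ m ∣_) pᵐpⁿ⁻ᵐ≡pⁿ (m∣m*n (p ℕ.^ (n ∸ m)))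
  where
  pᵐpⁿ⁻ᵐ≡pⁿ : p ℕ.^ m ℕ.* p ℕ.^ (n ∸ m) ≡ p ℕ.^ n
  pᵐpⁿ⁻ᵐ≡pⁿ = trans (sym (ℕ.^-distribˡ-+-* p m (n ∸ m))) (cong (p ℕ.^_) (ℕ.m+[n∸m]≡n m≤n))

^-cancelʳ-∣ : ∀ {p m n} → 1 < p → p ℕ.^ m ∣ p ℕ.^ n → m ≤ n
^-cancelʳ-∣ {p} {m} {n} 1<p pᵐ∣pⁿ = ℕ.≮⇒≥ λ n<m →
  ℕ.<⇒≱ (ℕ.^-monoʳ-< p 1<p n<m) (∣⇒≤ {{ℕ.m^n≢0 p n {{ℕ.>-nonZero (ℕ.<-trans ℕ.z<s 1<p)}}}} pᵐ∣pⁿ)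

prime-power-valuation : ∀ {q p n w} → Prime q → Prime p →
  q ℕ.^ n ∣ p ℕ.^ w → ¬ q ℕ.^ suc n ∣ p ℕ.^ w → n ≡ 0 ⊎ n ≡ w
prime-power-valuation {n = zero} _ _ _ _ = inj₁ refl
prime-power-valuation {q} {p} {suc n} {w} q-prime p-prime qⁿ∣pʷ qⁿ⁺¹∤pʷ
  with prime∣prime^⇒≡ {w = w} q-prime p-prime (∣-trans (m∣m*n (q ℕ.^ n)) qⁿ∣pʷ)
... | refl = inj₂ (ℕ.≤-antisym (^-cancelʳ-∣ 1<p qⁿ∣pʷ) (ℕ.≮⇒≥ (qⁿ⁺¹∤pʷ ∘ ^-monoʳ-∣ p)))
  where
  1<p : 1 < p
  1<p = ℕ.nonTrivial⇒n>1 p {{prime⇒nonTrivial p-prime}}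

odd-prime∤2^ : ∀ {p} → Prime p → 2 < p → ∀ j → ¬ p ∣ 2 ℕ.^ j
odd-prime∤2^ p-prime 2<p j p∣2ʲ = ℕ.<⇒≱ 2<p (∣⇒≤ (prime∣^⇒∣ 2 j p-prime p∣2ʲ))

infix 4 _≡_mod_

record _≡_mod_ (a b : ℤ) (n : ℕ) : Set where
  constructor ∣-difference
  field
    n∣a-b : + n Signed.∣ a - b

module _ {n : ℕ} where

  ≡-mod-refl : ∀ {a} → a ≡ a mod n
  ≡-mod-refl {a} = ∣-difference (Signed.divides (+ 0) (a-a≡0 a (+ n)))
    where
    a-a≡0 : ∀ a N → a - a ≡ + 0 * N
    a-a≡0 = solve-∀

  +-cong-mod : ∀ {a b c e} → a ≡ c mod n → b ≡ e mod n → a + b ≡ c + e mod n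
  +-cong-mod {a} {b} {c} {e} (∣-difference n∣a-c) (∣-difference n∣b-e) =
    ∣-difference (subst (+ n Signed.∣_) (regroup a b c e) (Signed.∣m∣n⇒∣m+n n∣a-c n∣b-e))
    where
    regroup : ∀ a b c e → (a - c) + (b - e) ≡ (a + b) - (c + e)
    regroup = solve-∀

  +-multiple-mod : ∀ {a c} b → a ≡ c mod n → a + + n * b ≡ c mod n
  +-multiple-mod {a} {c} b (∣-difference n∣a-c) =
    ∣-difference (subst (+ n Signed.∣_) (regroup a b c (+ n)) (Signed.∣m∣n⇒∣m+n n∣a-c (Signed.divides b refl)))
    where
    regroup : ∀ a b c N → (a - c) + b * N ≡ (a + N * b) - c
    regroup = solve-∀

  -multiple-mod : ∀ a b → a - + n * b ≡ a mod n
  -multiple-mod a b = ∣-difference (Signed.divides (- b) (regroup a b (+ n)))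
    where
    regroup : ∀ a b N → (a - N * b) - a ≡ - b * N
    regroup = solve-∀

  ∤-mod : ∀ {a c} → a ≡ c mod n → ¬ n ∣ ∣ c ∣ → ¬ n ∣ ∣ a ∣
  ∤-mod {a} {c} (∣-difference n∣a-c) n∤c n∣a = n∤c (Signed.∣⇒∣ᵤ (subst (+ n Signed.∣_) (a-[a-c]≡c a c)
    (Signed.∣m∣n⇒∣m-n (Signed.∣ᵤ⇒∣ {i = a} n∣a) n∣a-c)))
    where
    a-[a-c]≡c : ∀ a c → a - (a - c) ≡ c
    a-[a-c]≡c = solve-∀

module ℤ[θ] (p : ℕ) where

  norm : ℤ × ℤ → ℤ
  norm (a , b) = a * a + + p * a * b - b * b

  ·1+θ : ℤ × ℤ → ℤ × ℤ
  ·1+θ (a , b) = a + b , a + b + + p * b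

  ·θ : ℤ × ℤ → ℤ × ℤ
  ·θ (a , b) = b , a + + p * b

  [1+θ]^_ : ℕ → ℤ × ℤ
  [1+θ]^ zero  = + 1 , + 0
  [1+θ]^ suc n = ·1+θ ([1+θ]^ n)

  norm-·1+θ : ∀ x → norm (·1+θ x) ≡ + p * norm x
  norm-·1+θ (a , b) = identity (+ p) a b
    where
    identity : ∀ P a b → (a + b) * (a + b) + P * (a + b) * (a + b + P * b) - (a + b + P * b) * (a + b + P * b)
                       ≡ P * (a * a + P * a * b - b * b)
    identity = solve-∀

  norm-·θ : ∀ x → norm (·θ x) ≡ - norm x
  norm-·θ (a , b) = identity (+ p) a b
    where
    identity : ∀ P a b → b * b + P * b * (a + P * b) - (a + P * b) * (a + P * b) ≡ - (a * a + P * a * b - b * b)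
    identity = solve-∀

  norm-[1+θ]^ : ∀ n → norm ([1+θ]^ n) ≡ (+ p) ^ n
  norm-[1+θ]^ zero    = norm1≡1 (+ p)
    where
    norm1≡1 : ∀ P → + 1 * + 1 + P * + 1 * + 0 - + 0 * + 0 ≡ + 1
    norm1≡1 = solve-∀
  norm-[1+θ]^ (suc n) = trans (norm-·1+θ ([1+θ]^ n)) (cong (+ p *_) (norm-[1+θ]^ n))

  ·1+θ-mod : ∀ x j → proj₁ x ≡ + (2 ℕ.^ j) mod p → proj₂ x ≡ + (2 ℕ.^ j) mod p →
             proj₁ (·1+θ x) ≡ + (2 ℕ.^ suc j) mod p × proj₂ (·1+θ x) ≡ + (2 ℕ.^ suc j) mod p
  ·1+θ-mod (a , b) j a≡2ʲ b≡2ʲ = a+b≡2ʲ⁺¹ , +-multiple-mod b a+b≡2ʲ⁺¹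
    where
    2ʲ+2ʲ≡2ʲ⁺¹ : + (2 ℕ.^ j) + + (2 ℕ.^ j) ≡ + (2 ℕ.^ suc j)
    2ʲ+2ʲ≡2ʲ⁺¹ = trans (cong (λ t → + (2 ℕ.^ j) + + t) (sym (ℕ.+-identityʳ (2 ℕ.^ j))))
                       (sym (ℤ.pos-+ (2 ℕ.^ j) (2 ℕ.^ j ℕ.+ 0)))
    a+b≡2ʲ⁺¹ : a + b ≡ + (2 ℕ.^ suc j) mod p
    a+b≡2ʲ⁺¹ = subst (λ t → a + b ≡ t mod p) 2ʲ+2ʲ≡2ʲ⁺¹ (+-cong-mod a≡2ʲ b≡2ʲ)

  [1+θ]^-mod : ∀ j → proj₁ ([1+θ]^ suc j) ≡ + (2 ℕ.^ j) mod p × proj₂ ([1+θ]^ suc j) ≡ + (2 ℕ.^ j) mod p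
  [1+θ]^-mod zero    = ≡-mod-refl , +-multiple-mod (+ 0) ≡-mod-refl
  [1+θ]^-mod (suc j) = uncurry (·1+θ-mod ([1+θ]^ suc j) j) ([1+θ]^-mod j)

  representation : Prime p → 2 < p → ∀ n .{{_ : NonZero n}} ε → ε ≡ + 1 ⊎ ε ≡ - + 1 →
    ∃ λ x → norm x ≡ ε * (+ p) ^ n × ¬ p ∣ ∣ proj₂ x ∣
  representation p-prime 2<p (suc j) ε (inj₁ refl) =
    [1+θ]^ suc j ,
    trans (norm-[1+θ]^ (suc j)) (sym (ℤ.*-identityˡ _)) ,
    ∤-mod (proj₂ ([1+θ]^-mod j)) (odd-prime∤2^ p-prime 2<p j)
  representation p-prime 2<p (suc j) ε (inj₂ refl) =
    ·θ ([1+θ]^ suc j) ,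
    trans (norm-·θ ([1+θ]^ suc j)) (trans (cong -_ (norm-[1+θ]^ (suc j))) (sym (ℤ.-1*i≡-i _))) ,
    ∤-mod (+-multiple-mod _ (proj₁ ([1+θ]^-mod j))) (odd-prime∤2^ p-prime 2<p j)

allowed-0 : ∀ κ ω → Allowed κ ω 0
allowed-0 campana (fin _ _) = inj₁ refl
allowed-0 darmon  (fin w _) = w ∣0
allowed-0 _       ∞         = refl

allowed-weight : ∀ κ {w} (h : 2 ≤ w) → Allowed κ (fin w h) w
allowed-weight campana _ = inj₂ ℕ.≤-refl
allowed-weight darmon  _ = ∣-refl

prime∣pʷ∧∣t⇒p∣t : ∀ {q p w t} → Prime q → Prime p → q ∣ p ℕ.^ w → q ∣ t → p ∣ t
prime∣pʷ∧∣t⇒p∣t {w = w} {t} q-prime p-prime q∣pʷ q∣t =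
  subst (_∣ t) (prime∣prime^⇒≡ {w = w} q-prime p-prime q∣pʷ) q∣t

localCond-coprime : ∀ κ ω {p q} w t → Prime p → Prime q → ¬ p ∣ ∣ t ∣ → LocalCond κ ω q (+ (p ℕ.^ w)) t
localCond-coprime κ ω _ _ _ _ _ zero _ = allowed-0 κ ω
localCond-coprime κ ω {q = q} w t p-prime q-prime p∤t (suc n) (qⁿ⁺¹∣pʷ , qⁿ⁺¹∣t , _) =
  contradiction (prime∣pʷ∧∣t⇒p∣t {w = w} q-prime p-prime (q∣qⁿ⁺¹ qⁿ⁺¹∣pʷ) (q∣qⁿ⁺¹ qⁿ⁺¹∣t)) p∤t
  where
  q∣qⁿ⁺¹ : ∀ {s} → q ℕ.^ suc n ∣ s → q ∣ s
  q∣qⁿ⁺¹ = ∣-trans (m∣m*n (q ℕ.^ n))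

n∣∣c*n∣ : ∀ c n → n ∣ ∣ c * + n ∣
n∣∣c*n∣ c n = subst (n ∣_) (sym (ℤ.abs-* c (+ n))) (n∣m*n ∣ c ∣)

localCond-multiple : ∀ κ {p q} w (h : 2 ≤ w) (c : ℤ) → Prime p → Prime q →
  LocalCond κ (fin w h) q (+ (p ℕ.^ w)) (c * + (p ℕ.^ w))
localCond-multiple κ {p} w h c p-prime q-prime n (qⁿ∣pʷ , _ , qⁿ⁺¹∤both)
  with prime-power-valuation {n = n} {w} q-prime p-prime qⁿ∣pʷ
         (λ qⁿ⁺¹∣pʷ → qⁿ⁺¹∤both (qⁿ⁺¹∣pʷ , ∣-trans qⁿ⁺¹∣pʷ (n∣∣c*n∣ c (p ℕ.^ w))))
... | inj₁ refl = allowed-0 κ (fin w h)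
... | inj₂ refl = allowed-weight κ h

primitiveCoords-coprime : ∀ {p} w (x : Fin 3 → ℤ) (l : Fin 3) → Prime p → ¬ p ∣ ∣ x l ∣ →
  PrimitiveCoords (+ (p ℕ.^ w)) x
primitiveCoords-coprime w x l p-prime p∤xₗ q q-prime (q∣pʷ , q∣x) =
  p∤xₗ (prime∣pʷ∧∣t⇒p∣t {w = w} q-prime p-prime q∣pʷ (component l q∣x))
  where
  component : ∀ l → (q ∣ ∣ x zero ∣) × (q ∣ ∣ x (suc zero) ∣) × (q ∣ ∣ x (suc (suc zero)) ∣) →
              q ∣ ∣ x l ∣
  component zero             (q∣x₁ , _ , _) = q∣x₁
  component (suc zero)       (_ , q∣x₂ , _) = q∣x₂
  component (suc (suc zero)) (_ , _ , q∣x₃) = q∣x₃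

lookup-insertAt-elim : ∀ {a ℓ} {A : Set a} {n} (P : Fin (suc n) → A → Set ℓ) (xs : Vec A n) i v →
  P i v → (∀ l j → P l (lookup xs j)) → ∀ l → P l (lookup (insertAt xs i v) l)
lookup-insertAt-elim P xs i v Pᵢv Pxs l with i ≟ l
... | yes refl = subst (P i) (sym (insertAt-lookup xs i v)) Pᵢv
... | no i≢l = subst (P l) lookup-punchOut (Pxs l (punchOut i≢l))
  where
  lookup-punchOut : lookup xs (punchOut i≢l) ≡ lookup (insertAt xs i v) l
  lookup-punchOut = trans (sym (insertAt-punchIn xs i v (punchOut i≢l)))
                          (cong (lookup (insertAt xs i v)) (punchIn-punchOut i≢l))

onX-insertAt : ∀ m x₀ a b c i → x₀ * (a * a + b * b + c * c) - a * b * c ≡ m * x₀ ^ 3 →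
  OnX m x₀ (lookup (insertAt (b ∷ c ∷ []) i a))
onX-insertAt _ _  _ _ _ zero             eq = eq
onX-insertAt _ x₀ a b c (suc zero)       eq = trans (symmetric x₀ a b c) eq
  where
  symmetric : ∀ x₀ a b c → x₀ * (b * b + a * a + c * c) - b * a * c ≡ x₀ * (a * a + b * b + c * c) - a * b * c
  symmetric = solve-∀
onX-insertAt _ x₀ a b c (suc (suc zero)) eq = trans (symmetric x₀ a b c) eq
  where
  symmetric : ∀ x₀ a b c → x₀ * (b * b + c * c + a * a) - b * c * a ≡ x₀ * (a * a + b * b + c * c) - a * b * c
  symmetric = solve-∀

markoff-expansion : ∀ P k A B d →
  let r = + 2 + P * P ; Y = k * B ; X = Y - P * (k * A) in
  d * (r * d * (r * d) + X * X + Y * Y) - r * d * X * Y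
    ≡ r * r * (d * d * d) + P * P * (A * A + P * A * B - B * B) * (k * k * d)
markoff-expansion = solve-∀

square : ∀ x → x ^ 2 ≡ x * x
square x = cong (x *_) (ℤ.*-identityʳ x)

cube : ∀ x → x ^ 3 ≡ x * x * x
cube x = trans (cong (x *_) (square x)) (sym (ℤ.*-assoc x x x))

module MarkoffPoint {p : ℕ} (p-prime : Prime p) {k : ℕ} (p∤k : ¬ p ∣ k)
                    (A B : ℤ) (p∤B : ¬ p ∣ ∣ B ∣) (w : ℕ) where

  open ℤ[θ] p using (norm)

  x₀ r R X Y : ℤ
  x₀ = + (p ℕ.^ w)
  r  = + 2 + + p * + p
  R  = r * x₀
  Y  = + k * B
  X  = Y - + p * (+ k * A)

  p∤Y : ¬ p ∣ ∣ Y ∣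
  p∤Y p∣Y = [ p∤k , p∤B ]′ (euclidsLemma k ∣ B ∣ p-prime (subst (p ∣_) (ℤ.abs-* (+ k) B) p∣Y))

  p∤X : ¬ p ∣ ∣ X ∣
  p∤X = ∤-mod (-multiple-mod Y (+ k * A)) p∤Y

  point : Fin 3 → Fin 3 → ℤ
  point i = lookup (insertAt (X ∷ Y ∷ []) i R)

  onSurface : ∀ e → + p * + p * norm (A , B) ≡ e * (x₀ * x₀) → ∀ i →
    OnX ((+ 2 + (+ p) ^ 2) ^ 2 + e * (+ k) ^ 2) x₀ (point i)
  onSurface e p²norm≡ex₀² i = onX-insertAt ((+ 2 + (+ p) ^ 2) ^ 2 + e * (+ k) ^ 2) x₀ R X Y i (begin
    x₀ * (R * R + X * X + Y * Y) - R * X * Y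
      ≡⟨ markoff-expansion (+ p) (+ k) A B x₀ ⟩
    r * r * (x₀ * x₀ * x₀) + + p * + p * norm (A , B) * (+ k * + k * x₀)
      ≡⟨ cong (λ t → r * r * (x₀ * x₀ * x₀) + t * (+ k * + k * x₀)) p²norm≡ex₀² ⟩
    r * r * (x₀ * x₀ * x₀) + e * (x₀ * x₀) * (+ k * + k * x₀)
      ≡⟨ collect r e (+ k) x₀ ⟩
    (r * r + e * (+ k * + k)) * (x₀ * x₀ * x₀)
      ≡⟨ unfold-powers ⟨
    ((+ 2 + (+ p) ^ 2) ^ 2 + e * (+ k) ^ 2) * x₀ ^ 3 ∎)
    where
    open ≡-Reasoning
    collect : ∀ r e k d → r * r * (d * d * d) + e * (d * d) * (k * k * d) ≡ (r * r + e * (k * k)) * (d * d * d)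
    collect = solve-∀
    unfold-powers : ((+ 2 + (+ p) ^ 2) ^ 2 + e * (+ k) ^ 2) * x₀ ^ 3 ≡ (r * r + e * (+ k * + k)) * (x₀ * x₀ * x₀)
    unfold-powers rewrite square (+ p) | square r | square (+ k) | cube x₀ = refl

  x₀≢0 : x₀ ≢ + 0
  x₀≢0 = ℕ.≢-nonZero⁻¹ (p ℕ.^ w) {{ℕ.m^n≢0 p w {{prime⇒nonZero p-prime}}}} ∘ ℤ.+-injective

  strPoint : ∀ κ ω i {h} → ω i ≡ fin w h → ∀ e → + p * + p * norm (A , B) ≡ e * (x₀ * x₀) →
    StrPoint κ ((+ 2 + (+ p) ^ 2) ^ 2 + e * (+ k) ^ 2) ω x₀ (point i)
  strPoint κ ω i {h} ωᵢ≡ e p²norm≡ex₀² = x₀≢0 , primitivity , onSurface e p²norm≡ex₀² i , local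
    where
    primitivity : PrimitiveCoords x₀ (point i)
    primitivity = primitiveCoords-coprime w (point i) (punchIn i zero) p-prime
      (subst (λ t → ¬ p ∣ ∣ t ∣) (sym (insertAt-punchIn (X ∷ Y ∷ []) i R zero)) p∤X)
    local : ∀ l q → Prime q → LocalCond κ (ω l) q x₀ (point i l)
    local l q q-prime = lookup-insertAt-elim (λ l t → LocalCond κ (ω l) q x₀ t) (X ∷ Y ∷ []) i R
      (subst (λ o → LocalCond κ o q x₀ R) (sym ωᵢ≡) (localCond-multiple κ w h r p-prime q-prime))
      (λ { l zero → localCond-coprime κ (ω l) w X p-prime q-prime p∤X
         ; l (suc zero) → localCond-coprime κ (ω l) w Y p-prime q-prime p∤Y })
      l

isFinite⇒fin : ∀ o → IsFinite o → ∃₂ λ w (h : 2 ≤ w) → o ≡ fin w h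
isFinite⇒fin (fin w h) _ = w , h , refl

sign-of-± : ∀ {m} a c b → m ≡ a + c * b ⊎ m ≡ a - c * b →
  ∃ λ ε → (ε ≡ + 1 ⊎ ε ≡ - + 1) × m ≡ a + ε * c * b
sign-of-± a c b (inj₁ m≡) = + 1   , inj₁ refl , trans m≡ (plus a c b)
  where
  plus : ∀ a c b → a + c * b ≡ a + + 1 * c * b
  plus = solve-∀
sign-of-± a c b (inj₂ m≡) = - + 1 , inj₂ refl , trans m≡ (minus a c b)
  where
  minus : ∀ a c b → a - c * b ≡ a + - + 1 * c * b
  minus = solve-∀

pos-^ : ∀ m n → + (m ℕ.^ n) ≡ (+ m) ^ n
pos-^ m zero    = refl
pos-^ m (suc n) = trans (ℤ.pos-* m (m ℕ.^ n)) (cong (+ m *_) (pos-^ m n))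

shift-exponent : ∀ p ε α W →
  + p * + p * (ε * (+ p) ^ (W ℕ.+ W ℕ.+ α)) ≡ ε * (+ p) ^ α * (+ (p ℕ.^ suc W) * + (p ℕ.^ suc W))
shift-exponent p ε α W = begin
  P * P * (ε * P ^ (W ℕ.+ W ℕ.+ α))
    ≡⟨ cong (λ t → P * P * (ε * t)) (ℤ.^-distribˡ-+-* P (W ℕ.+ W) α) ⟩
  P * P * (ε * (P ^ (W ℕ.+ W) * P ^ α))
    ≡⟨ cong (λ t → P * P * (ε * (t * P ^ α))) (ℤ.^-distribˡ-+-* P W W) ⟩
  P * P * (ε * (P ^ W * P ^ W * P ^ α))
    ≡⟨ regroup P ε (P ^ W) (P ^ α) ⟩
  ε * P ^ α * (P ^ suc W * P ^ suc W)
    ≡⟨ cong (λ t → ε * P ^ α * (t * t)) (pos-^ p (suc W)) ⟨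
  ε * P ^ α * (+ (p ℕ.^ suc W) * + (p ℕ.^ suc W)) ∎
  where
  open ≡-Reasoning
  P = + p
  regroup : ∀ x ε y z → x * x * (ε * (y * y * z)) ≡ ε * z * (x * y * (x * y))
  regroup = solve-∀

theorem4p2 : (p : ℕ) → Prime p → 2 < p → ClTrivial (+ (p ℕ.^ 2 ℕ.+ 4)) →
    (ω : Fin 3 → Weight) → Σ (Fin 3) (λ i → IsFinite (ω i)) →
    (m : ℤ) (α k : ℕ) → 0 < k → ¬ (p ∣ k) →
    ((m ≡ (+ 2 + (+ p) ^ 2) ^ 2 + (+ p) ^ α * (+ k) ^ 2) ⊎ (m ≡ (+ 2 + (+ p) ^ 2) ^ 2 - (+ p) ^ α * (+ k) ^ 2)) →
    m ≢ + 0 → m ≢ + 4 →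
    (κ : Kind) → Σ ℤ λ x0 → Σ (Fin 3 → ℤ) λ x → StrPoint κ m ω x0 x
theorem4p2 p p-prime 2<p _ ω (i , ωᵢ-finite) m α k _ p∤k m≡± _ _ κ
  with isFinite⇒fin (ω i) ωᵢ-finite | sign-of-± ((+ 2 + (+ p) ^ 2) ^ 2) ((+ p) ^ α) ((+ k) ^ 2) m≡±
... | _ , ℕ.s≤s (ℕ.s≤s {n = w} _) , ωᵢ≡ | ε , ε≡±1 , m≡
  with ℤ[θ].representation p p-prime 2<p (suc w ℕ.+ suc w ℕ.+ α) ε ε≡±1
... | (A , B) , norm≡εpⁿ , p∤B =
  x₀ , point i ,
  subst (λ m → StrPoint κ m ω x₀ (point i)) (sym m≡)
    (strPoint κ ω i ωᵢ≡ (ε * (+ p) ^ α) (trans (cong (+ p * + p *_) norm≡εpⁿ) (shift-exponent p ε α (suc w))))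
  where
  open MarkoffPoint p-prime p∤k A B p∤B (suc (suc w))
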